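{- Let $1 \le t_1 < \cdots < t_k < n$ be integers and $G = G_n\langle t_1, \ldots, t_k\rangle$. Then $\omega(G) \le k+1$, and equality holds if and only if $t_i = i t_1$ for each $i \in \{1, \ldots, k\}$.
   Context: For integers $1 \le t_1 < \cdots < t_k < n$, the Toeplitz graph $G_n\langle t_1, \ldots, t_k\rangle$ is the simple graph with vertex set $\{1, \ldots, n\}$ in which distinct vertices $i,j$ are adjacent iff $|i-j| \in \{t_1, \ldots, t_k\}$. $\omega(G)$ denotes the clique number. -}

module Defs where

open import Data.Nat using (ℕ; suc; _<_; _≤_; ∣_-_∣)
open import Data.Fin using (Fin; toℕ)
open import Data.List using (List)
open import Data.List.Relation.Unary.AllPairs using (AllPairs)
open import Data.Product using (∃; _×_)
open import Relation.Binary.PropositionalEquality using (_≡_; _≢_)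

-- Generating set {t_1,...,t_k} as a function t : Fin k → ℕ (index i ↦ t_{i+1}).
StrictlyIncreasing : ∀ {k} → (Fin k → ℕ) → Set
StrictlyIncreasing {k} t = ∀ (i j : Fin k) → toℕ i < toℕ j → t i < t j

-- Toeplitz graph G_n⟨t_1,...,t_k⟩ on vertices Fin n (vertex v ↔ v+1 ∈ {1..n}).
-- Distinct vertices u,v adjacent iff |u - v| ∈ {t_1,...,t_k}.
ToeplitzAdj : ∀ {k} (n : ℕ) (t : Fin k → ℕ) → Fin n → Fin n → Set
ToeplitzAdj n t u v = (u ≢ v) × ∃ λ i → ∣ toℕ u - toℕ v ∣ ≡ t i

IsClique : ∀ {k} (n : ℕ) (t : Fin k → ℕ) → List (Fin n) → Set
IsClique n t = AllPairs (ToeplitzAdj n t)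

{-# OPTIONS --safe #-}
-- Let x be the least vertex of a clique. Every other vertex y has y − x = t_p
-- for some p, and distinct y give distinct p, so the clique has at most k + 1
-- vertices. If it has exactly k + 1, then x + t_1, …, x + t_k are all vertices,
-- so each t_j − t_1 (j > 1) is again some t_q. These differences increase with
-- j and lie below t_j, which forces t_j − t_1 = t_{j−1}, i.e. t_j = j t_1.
-- Conversely, when t_j = j t_1 the multiples 0, t_1, …, k t_1 form a clique.
module Submission where

open import Defs
open import Data.Nat using (ℕ; zero; suc; pred; _+_; _*_; _∸_; _≤_; _<_; ∣_-_∣; z≤n; z<s; s≤s; s<s; s<s⁻¹; s≤s⁻¹; NonZero; >-nonZero)
open import Data.Nat.Properties
open import Data.Fin as Fin using (Fin; zero; suc; toℕ; fromℕ; fromℕ<; inject₁; punchIn; punchOut)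
import Data.Fin.Properties as Finₚ
open import Data.List using (List; length; lookup; tabulate)
open import Data.List.Properties using (length-tabulate)
open import Data.List.Membership.Propositional.Properties using (∈-lookup)
import Data.List.Relation.Unary.All as All
open import Data.List.Relation.Unary.AllPairs using (AllPairs; _∷_)
open import Data.List.Relation.Unary.AllPairs.Properties using (tabulate⁺)
open import Data.Sum using (inj₁; inj₂)
open import Data.Product using (∃; _×_; _,_; proj₁; proj₂)
open import Function.Base using (_∘_)
open import Function.Bundles using (_⇔_; mk⇔)
open import Function.Definitions using (Injective)
open import Relation.Binary.PropositionalEquality
open import Relation.Binary.Definitions using (tri<; tri≈; tri>)
open import Relation.Nullary using (yes; no; contradiction)

injective⇒surjective : ∀ {k} {f : Fin k → Fin k} → Injective _≡_ _≡_ f → ∀ y → ∃ λ x → f x ≡ y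
injective⇒surjective {suc k} {f} f-inj y with Finₚ.any? (λ x → f x Fin.≟ y)
... | yes hit = hit
... | no miss = contradiction (Finₚ.injective⇒≤ g-inj) 1+n≰n
  where
    y≢f : ∀ x → y ≢ f x
    y≢f x y≡fx = miss (x , sym y≡fx)

    g : Fin (suc k) → Fin k
    g x = punchOut (y≢f x)

    g-inj : Injective _≡_ _≡_ g
    g-inj = f-inj ∘ Finₚ.punchOut-injective (y≢f _) (y≢f _)

argmin : ∀ {L} (a : Fin (suc L) → ℕ) → ∃ λ r → ∀ i → a r ≤ a i
argmin {zero} a = zero , λ { zero → ≤-refl }
argmin {suc L} a with argmin (a ∘ suc)
... | r , a-r≤ with a zero ≤? a (suc r)
...   | yes ≤a-r = zero , λ { zero → ≤-refl ; (suc i) → ≤-trans ≤a-r (a-r≤ i) }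
...   | no ≰a-r = suc r , λ { zero → <⇒≤ (≰⇒> ≰a-r) ; (suc i) → a-r≤ i }

AllPairs-lookup : ∀ {A : Set} {R : A → A → Set} {xs : List A} → AllPairs R xs →
                  ∀ {i j} → i Fin.< j → R (lookup xs i) (lookup xs j)
AllPairs-lookup (Rx ∷ _) {zero} {suc j} _ = All.lookup Rx (∈-lookup j)
AllPairs-lookup (_ ∷ Rxs) {suc i} {suc j} i<j = AllPairs-lookup Rxs (s<s⁻¹ i<j)

module _ {k} {f : Fin k → ℕ} (f-inc : StrictlyIncreasing f) where

  StrictlyIncreasing⇒monotone : ∀ {i j} → toℕ i ≤ toℕ j → f i ≤ f j
  StrictlyIncreasing⇒monotone {i} {j} i≤j with m≤n⇒m<n∨m≡n i≤j
  ... | inj₁ i<j = <⇒≤ (f-inc i j i<j)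
  ... | inj₂ i≡j = ≤-reflexive (cong f (Finₚ.toℕ-injective i≡j))

  StrictlyIncreasing⇒reflects-< : ∀ {i j} → f i < f j → toℕ i < toℕ j
  StrictlyIncreasing⇒reflects-< fi<fj = ≰⇒> (<⇒≱ fi<fj ∘ StrictlyIncreasing⇒monotone)

StrictlyIncreasing⇒positive : ∀ {k} {f : Fin (suc k) → ℕ} → StrictlyIncreasing f → 1 ≤ f zero → ∀ i → 1 ≤ f i
StrictlyIncreasing⇒positive f-inc f₀-pos i = ≤-trans f₀-pos (StrictlyIncreasing⇒monotone f-inc z≤n)

StrictlyIncreasing⇒toℕ≤ : ∀ {k} {f : Fin k → ℕ} → StrictlyIncreasing f → ∀ i → toℕ i ≤ f i
StrictlyIncreasing⇒toℕ≤ f-inc zero = z≤n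
StrictlyIncreasing⇒toℕ≤ {suc k} {f} f-inc (suc i) =
  m≤pred[n]⇒suc[m]≤n {{f-suc-nonZero i}} (StrictlyIncreasing⇒toℕ≤ g-inc i)
  where
    f-suc-nonZero : ∀ i → NonZero (f (suc i))
    f-suc-nonZero i = >-nonZero (≤-<-trans z≤n (f-inc zero (suc i) z<s))

    g : Fin k → ℕ
    g = pred ∘ f ∘ suc

    g-inc : StrictlyIncreasing g
    g-inc i j i<j = <⇒≤pred (subst (_< f (suc j)) (sym (suc-pred _ {{f-suc-nonZero i}}))
                                   (f-inc (suc i) (suc j) (s<s i<j)))

step⇒arithmetic : ∀ {m} (t : Fin (suc m) → ℕ) → (∀ i → t (suc i) ≡ t (inject₁ i) + t zero) →
                  ∀ i → t i ≡ suc (toℕ i) * t zero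
step⇒arithmetic t step zero = sym (+-identityʳ (t zero))
step⇒arithmetic {suc m} t step (suc i) = begin
  t (suc i)                      ≡⟨ step i ⟩
  t (inject₁ i) + t zero         ≡⟨ cong (_+ t zero) (step⇒arithmetic (t ∘ inject₁) (step ∘ inject₁) i) ⟩
  suc (toℕ i) * t zero + t zero  ≡⟨ +-comm (suc (toℕ i) * t zero) (t zero) ⟩
  suc (suc (toℕ i)) * t zero     ∎
  where open ≡-Reasoning

differenceClosed⇒arithmetic : ∀ {m} {t : Fin (suc m) → ℕ} → 1 ≤ t zero → StrictlyIncreasing t →
                              (∀ j → ∃ λ q → t (suc j) ≡ t q + t zero) →
                              ∀ i → t i ≡ suc (toℕ i) * t zero
differenceClosed⇒arithmetic {m} {t} t₀-pos t-inc closed = step⇒arithmetic t step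
  where
    q : Fin m → Fin (suc m)
    q j = proj₁ (closed j)

    t-suc≡t-q+t₀ : ∀ j → t (suc j) ≡ t (q j) + t zero
    t-suc≡t-q+t₀ j = proj₂ (closed j)

    q<suc : ∀ j → toℕ (q j) < suc (toℕ j)
    q<suc j = StrictlyIncreasing⇒reflects-< t-inc
                (subst (t (q j) <_) (sym (t-suc≡t-q+t₀ j)) (m<m+n (t (q j)) t₀-pos))

    q-inc : StrictlyIncreasing (toℕ ∘ q)
    q-inc i j i<j = StrictlyIncreasing⇒reflects-< t-inc (+-cancelʳ-< (t zero) _ _
                      (subst₂ _<_ (t-suc≡t-q+t₀ i) (t-suc≡t-q+t₀ j) (t-inc (suc i) (suc j) (s<s i<j))))

    q≡inject₁ : ∀ j → q j ≡ inject₁ j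
    q≡inject₁ j = Finₚ.toℕ-injective (trans
      (≤-antisym (s≤s⁻¹ (q<suc j)) (StrictlyIncreasing⇒toℕ≤ q-inc j))
      (sym (Finₚ.toℕ-inject₁ j)))

    step : ∀ j → t (suc j) ≡ t (inject₁ j) + t zero
    step j = trans (t-suc≡t-q+t₀ j) (cong (λ p → t p + t zero) (q≡inject₁ j))

positive-distance⇒≢ : ∀ {x y d} → ∣ x - y ∣ ≡ d → 1 ≤ d → x ≢ y
positive-distance⇒≢ d≡ 1≤d x≡y = >⇒≢ 1≤d (trans (sym d≡) (m≡n⇒∣m-n∣≡0 x≡y))

record DifferencesIn {k L} (t : Fin k → ℕ) (a : Fin L → ℕ) : Set where
  field difference : ∀ i j → i ≢ j → ∃ λ p → ∣ a i - a j ∣ ≡ t p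

open DifferencesIn

clique⇒DifferencesIn : ∀ {n k} {t : Fin k → ℕ} {C : List (Fin n)} →
                       IsClique n t C → DifferencesIn t (toℕ ∘ lookup C)
clique⇒DifferencesIn {C = C} clique .difference i j i≢j with Finₚ.<-cmp i j
... | tri< i<j _ _ = proj₂ (AllPairs-lookup clique i<j)
... | tri≈ _ i≡j _ = contradiction i≡j i≢j
... | tri> _ _ j<i with proj₂ (AllPairs-lookup clique j<i)
...   | p , d≡t = p , trans (∣-∣-comm (toℕ (lookup C i)) (toℕ (lookup C j))) d≡t

module _ {k} {t : Fin k → ℕ} (t-pos : ∀ p → 1 ≤ t p) where

  DifferencesIn⇒injective : ∀ {L} {a : Fin L → ℕ} → DifferencesIn t a → Injective _≡_ _≡_ a
  DifferencesIn⇒injective diff {i} {j} ai≡aj with i Fin.≟ j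
  ... | yes i≡j = i≡j
  ... | no i≢j with difference diff i j i≢j
  ...   | p , d≡t = contradiction ai≡aj (positive-distance⇒≢ d≡t (t-pos p))

  module FromMinimum {L} {a : Fin (suc L) → ℕ} (diff : DifferencesIn t a) where

    r : Fin (suc L)
    r = proj₁ (argmin a)

    offset : Fin L → Fin k
    offset j = proj₁ (difference diff (punchIn r j) r (Finₚ.punchInᵢ≢i r j))

    a≡a-r+t-offset : ∀ j → a (punchIn r j) ≡ a r + t (offset j)
    a≡a-r+t-offset j = begin
      a (punchIn r j)                      ≡⟨ m+[n∸m]≡n a-r≤ ⟨
      a r + (a (punchIn r j) ∸ a r)        ≡⟨ cong (a r +_) (m≤n⇒∣n-m∣≡n∸m a-r≤) ⟨
      a r + ∣ a (punchIn r j) - a r ∣      ≡⟨ cong (a r +_) (proj₂ (difference diff (punchIn r j) r (Finₚ.punchInᵢ≢i r j))) ⟩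
      a r + t (offset j)                   ∎
      where
        open ≡-Reasoning
        a-r≤ : a r ≤ a (punchIn r j)
        a-r≤ = proj₂ (argmin a) (punchIn r j)

    offset-injective : Injective _≡_ _≡_ offset
    offset-injective {i} {j} offset-i≡offset-j = Finₚ.punchIn-injective r i j
      (DifferencesIn⇒injective diff (begin
        a (punchIn r i)     ≡⟨ a≡a-r+t-offset i ⟩
        a r + t (offset i)  ≡⟨ cong (λ p → a r + t p) offset-i≡offset-j ⟩
        a r + t (offset j)  ≡⟨ a≡a-r+t-offset j ⟨
        a (punchIn r j)     ∎))
      where open ≡-Reasoning

    translates : L ≡ k → ∀ p → ∃ λ i → a i ≡ a r + t p
    translates refl p with injective⇒surjective offset-injective p
    ... | j , offset-j≡p = punchIn r j , trans (a≡a-r+t-offset j) (cong (λ p → a r + t p) offset-j≡p)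

  DifferencesIn⇒size≤ : ∀ {L} {a : Fin L → ℕ} → DifferencesIn t a → L ≤ suc k
  DifferencesIn⇒size≤ {zero} _ = z≤n
  DifferencesIn⇒size≤ {suc L} diff = s≤s (Finₚ.injective⇒≤ offset-injective)
    where open FromMinimum diff

translates⇒differenceClosed : ∀ {m} {t : Fin (suc m) → ℕ} {L} {a : Fin L → ℕ} {x} →
                              StrictlyIncreasing t → DifferencesIn t a →
                              (∀ p → ∃ λ i → a i ≡ x + t p) →
                              ∀ j → ∃ λ q → t (suc j) ≡ t q + t zero
translates⇒differenceClosed {t = t} {a = a} {x} t-inc diff has j with has (suc j) | has zero
... | uⱼ , a-uⱼ | u₀ , a-u₀ = proj₁ d , trans (sym (m∸n+n≡m t₀≤tⱼ)) (cong (_+ t zero) (trans gap (proj₂ d)))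
  where
    open ≡-Reasoning
    t₀≤tⱼ : t zero ≤ t (suc j)
    t₀≤tⱼ = <⇒≤ (t-inc zero (suc j) z<s)

    uⱼ≢u₀ : uⱼ ≢ u₀
    uⱼ≢u₀ uⱼ≡u₀ = <⇒≢ (t-inc zero (suc j) z<s)
      (sym (+-cancelˡ-≡ x _ _ (trans (sym a-uⱼ) (trans (cong a uⱼ≡u₀) a-u₀))))

    d : ∃ λ q → ∣ a uⱼ - a u₀ ∣ ≡ t q
    d = difference diff uⱼ u₀ uⱼ≢u₀

    gap : t (suc j) ∸ t zero ≡ ∣ a uⱼ - a u₀ ∣
    gap = begin
      t (suc j) ∸ t zero                 ≡⟨ m≤n⇒∣n-m∣≡n∸m t₀≤tⱼ ⟨
      ∣ t (suc j) - t zero ∣             ≡⟨ ∣m+n-m+o∣≡∣n-o∣ x (t (suc j)) (t zero) ⟨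
      ∣ x + t (suc j) - x + t zero ∣     ≡⟨ cong₂ ∣_-_∣ a-uⱼ a-u₀ ⟨
      ∣ a uⱼ - a u₀ ∣                    ∎

maximumDifferences⇒arithmetic : ∀ {m} {t : Fin (suc m) → ℕ} → 1 ≤ t zero → StrictlyIncreasing t →
                                ∀ {L} {a : Fin L → ℕ} → DifferencesIn t a → L ≡ suc (suc m) →
                                ∀ i → t i ≡ suc (toℕ i) * t zero
maximumDifferences⇒arithmetic t₀-pos t-inc diff refl =
  differenceClosed⇒arithmetic t₀-pos t-inc (translates⇒differenceClosed t-inc diff (translates refl))
  where open FromMinimum (StrictlyIncreasing⇒positive t-inc t₀-pos) diff

module Multiples {n m} {t : Fin (suc m) → ℕ} (t₀-pos : 1 ≤ t zero) (t-last<n : t (fromℕ m) < n)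
                 (arithmetic : ∀ i → t i ≡ suc (toℕ i) * t zero) where

  multiple : Fin (suc (suc m)) → Fin n
  multiple i = fromℕ< (≤-<-trans (*-monoˡ-≤ (t zero) (Finₚ.toℕ≤pred[n] i)) last<n)
    where
      last<n : suc m * t zero < n
      last<n = subst (_< n) (trans (arithmetic (fromℕ m)) (cong (λ x → suc x * t zero) (Finₚ.toℕ-fromℕ m)))
                            t-last<n

  toℕ-multiple : ∀ i → toℕ (multiple i) ≡ toℕ i * t zero
  toℕ-multiple i = Finₚ.toℕ-fromℕ< _

  distance : ∀ {i j : Fin (suc (suc m))} → i ≢ j → ∃ λ p → ∣ toℕ i - toℕ j ∣ ≡ suc (toℕ p)
  distance {i} {j} i≢j with ∣ toℕ i - toℕ j ∣ in d≡
  ... | zero = contradiction (Finₚ.toℕ-injective (∣m-n∣≡0⇒m≡n d≡)) i≢j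
  ... | suc e = fromℕ< e<suc-m , cong suc (sym (Finₚ.toℕ-fromℕ< e<suc-m))
    where
      e<suc-m : e < suc m
      e<suc-m = subst (_≤ suc m) d≡
        (≤-trans (∣m-n∣≤m⊔n (toℕ i) (toℕ j)) (⊔-lub (Finₚ.toℕ≤pred[n] i) (Finₚ.toℕ≤pred[n] j)))

  multiples-adjacent : ∀ {i j} → i ≢ j → ToeplitzAdj n t (multiple i) (multiple j)
  multiples-adjacent {i} {j} i≢j = multiple-i≢multiple-j , p , d≡t
    where
      open ≡-Reasoning
      p : Fin (suc m)
      p = proj₁ (distance i≢j)

      d≡t : ∣ toℕ (multiple i) - toℕ (multiple j) ∣ ≡ t p
      d≡t = begin
        ∣ toℕ (multiple i) - toℕ (multiple j) ∣   ≡⟨ cong₂ ∣_-_∣ (toℕ-multiple i) (toℕ-multiple j) ⟩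
        ∣ toℕ i * t zero - toℕ j * t zero ∣       ≡⟨ *-distribʳ-∣-∣ (t zero) (toℕ i) (toℕ j) ⟨
        ∣ toℕ i - toℕ j ∣ * t zero                ≡⟨ cong (_* t zero) (proj₂ (distance i≢j)) ⟩
        suc (toℕ p) * t zero                      ≡⟨ arithmetic p ⟨
        t p                                       ∎

      multiple-i≢multiple-j : multiple i ≢ multiple j
      multiple-i≢multiple-j = positive-distance⇒≢ d≡t
        (≤-trans t₀-pos (subst (t zero ≤_) (sym (arithmetic p)) (m≤m+n (t zero) _))) ∘ cong toℕ

  multiples-clique : IsClique n t (tabulate multiple)
  multiples-clique = tabulate⁺ multiples-adjacent

theorem8 : ∀ (n m : ℕ) (t : Fin (suc m) → ℕ)
           → 1 ≤ t zero → StrictlyIncreasing t → t (fromℕ m) < n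
           → ((C : List (Fin n)) → IsClique n t C → length C ≤ suc (suc m))
             × ((∃ λ (C : List (Fin n)) → IsClique n t C × length C ≡ suc (suc m))
                ⇔ (∀ (i : Fin (suc m)) → t i ≡ suc (toℕ i) * t zero))
theorem8 n m t t₀-pos t-inc t-last<n =
  (λ _ clique → DifferencesIn⇒size≤ t-pos (clique⇒DifferencesIn clique)) ,
  mk⇔ (λ (_ , clique , size) → maximumDifferences⇒arithmetic t₀-pos t-inc (clique⇒DifferencesIn clique) size)
      (λ arithmetic → let open Multiples {t = t} t₀-pos t-last<n arithmetic in
                      tabulate multiple , multiples-clique , length-tabulate multiple)
  where
    t-pos : ∀ p → 1 ≤ t p
    t-pos = StrictlyIncreasing⇒positive t-inc t₀-pos
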